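{- Let $\mathfrak R$ be a finite nonempty $\mathtt{loc}$-deterministic set of P-rules satisfying (A1) and (A2). Let $\lambda$ be a symbolic heap, $\xi$ a pure formula and $V$ a finite multiset of variables of sort $\mathtt{loc}$ such that $\lambda\triangleright_V\xi$. For every pair $(\mathfrak s,\mathfrak h)$, if $(\mathfrak s,\mathfrak h)\models_{\mathfrak R}\lambda$, $\mathfrak s(V)\cap\mathrm{dom}(\mathfrak h)=\emptyset$ and $\mathfrak s$ is injective on $V$, then $\mathfrak s\models\xi$.
   Context: Syntax. There is a set of sorts containing a distinguished sort $\mathtt{loc}$. For each sort $s$ there is a countably infinite set $\mathcal V_s$ of variables (pairwise disjoint) and a set $\mathcal C_s$ of constants, with $\mathcal C_{\mathtt{loc}}=\emptyset$. Terms of sort $s$ are the elements of $\mathcal V_s\cup\mathcal C_s$. A pure formula is a finite conjunction of equations $t\approx u$ and disequations $t\not\approx u$ between terms of the same sort. Each predicate symbol $p$ has a profile $(s_1,\dots,s_n)$, $n\ge1$, $s_1=\mathtt{loc}$. A spatial atom is a points-to atom $x\mapsto(t_1,\dots,t_k)$ ($x\in\mathcal V_{\mathtt{loc}}$, $t_i$ terms) or a predicate atom $p(x,t_2,\dots,t_n)$ with $x\in\mathcal V_{\mathtt{loc}}$, $t_i$ of sort $s_i$; $x$ is the root. A spatial formula is a separating conjunction of spatial atoms modulo associativity/commutativity ($\mathit{emp}$ if empty). A symbolic heap is $\phi\curlywedge\xi$ with $\phi$ spatial and $\xi$ pure. $\mathit{alloc}(\lambda)$ is the multiset of roots of the spatial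 atoms of $\lambda$. For a multiset $M$, $\{x,y\}\subseteq_m M$ means that $x,y$ occur in $M$ as two distinct occurrences. $\lambda\triangleright_V\xi$ holds iff every atom $\zeta$ of $\xi$ satisfies one of: (1) $\zeta$ occurs in $\lambda$; (2) $\zeta$ is $t\approx t$ for a variable $t$, or $\zeta$ is $t_1\not\approx t_2$ with $t_1,t_2$ distinct constants; (3) $\zeta$ is $x_1\not\approx x_2$ (up to commutativity) with $\{x_1,x_2\}\subseteq_m\mathit{alloc}(\lambda)+V$ (multiset union). An inductive rule is $p(x_1,\dots,x_n)\Leftarrow\lambda$ with pairwise distinct variables of the sorts of the profile of $p$ and $\lambda$ a symbolic heap; $p$ is its head. Semantics. Fix pairwise disjoint countably infinite sets $\mathfrak U_s$, $\mathfrak U=\bigcup_s\mathfrak U_s$, and an injective map $c\mapsto\dot c\in\mathfrak U_s$ on constants. A heap is a finite partial function from $\mathfrak U_{\mathtt{loc}}$ to finite tuples over $\mathfrak U$; $\uplus$ is union of heaps with disjoint domains. A store is a total sort-preserving map $\mathfrak s$ from terms to $\mathfrak U$ with $\mathfrak s(c)=\dot c$; it is injective on a multiset $V$ if $\{x,y\}\subseteq_m V$ implies $\mathfrak s(x)\neq\mathfrak s(y)$. $(\mathfrak s,\mathfrak h)\models_{\mathfrak R}\lambda$ is the least relation with: $\mathit{emp}$ iff $\mathfrak h=\emptyset$; $t\approx u$ / $t\not\approx u$ iff $\mathfrak s(t)=\mathfrak s(u)$ / $\ne$ (pure formulas do not depend on the heap; one writes $\mathfrak s\models\xi$); $x\mapsto(t_1,\dots,t_k)$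 iff $\mathfrak h$ is exactly the cell $\mathfrak s(x)\mapsto(\mathfrak s(t_1),\dots,\mathfrak s(t_k))$; conjunctions iff both conjuncts; $\lambda_1*\lambda_2$ iff $\mathfrak h=\mathfrak h_1\uplus\mathfrak h_2$ with $(\mathfrak s,\mathfrak h_i)\models_{\mathfrak R}\lambda_i$; $p(t_1,\dots,t_n)$ iff some rule $p(y_1,\dots,y_n)\Leftarrow\gamma$ of $\mathfrak R$ (renamed apart), with $\gamma'=\gamma\{y_i\leftarrow t_i\}$, and some store agreeing with $\mathfrak s$ outside the variables of $\gamma'$ not in $p(t_1,\dots,t_n)$, satisfy $\gamma'$ with heap $\mathfrak h$. P-rules. An inductive rule is a P-rule if it has the form $p(x_1,\dots,x_n)\Leftarrow x_1\mapsto(y_1,\dots,y_k)*q_1(z_1,\vec u_1)*\dots*q_m(z_m,\vec u_m)\curlywedge\xi$ ($m\ge0$, $y_i$ terms) where: (1) $\xi$ is a conjunction of disequations $u\not\approx v$ with $u\in\{x_1,..,x_n,y_1,..,y_k\}$, $v\in\{y_1,..,y_k\}\setminus\{x_1,..,x_n\}$; (2) $\{z_1,..,z_m\}=(\{y_1,..,y_k\}\setminus\{x_1,..,x_n\})\cap\mathcal V_{\mathtt{loc}}$ with the $z_j$ pairwise distinct; (3) every element of each $\vec u_i$ is in $\{x_1,..,x_n\}\cup\{y_1,..,y_k\}\cup\mathcal C$. (A1): every predicate symbol is productive (productive symbols: least set such that $p$ is productive if some rule with head $p$ has a body all of whose predicate symbols are productive). $\mathit{out}(p)$ is the least family of index sets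 such that $i\in\mathit{out}(p)$ if $s_i=\mathtt{loc}$ and some rule $p(x_1,\dots,x_n)\Leftarrow\lambda$ has $\lambda$ containing a points-to atom $x_1\mapsto(t_1,\dots,t_k)$ with $x_i\in\{t_1,..,t_k\}$ or a predicate atom $q(t_1,\dots,t_m)$ with $t_j=x_i$, $j\in\mathit{out}(q)$. (A2): for each $p$ of profile $(\mathtt{loc},s_2,..,s_n)$, $\mathit{out}(p)\supseteq\{2\le i\le n\mid s_i=\mathtt{loc}\}$. A set of P-rules is $\mathtt{loc}$-deterministic if (i) for any two distinct rules $p(\vec x_i)\Leftarrow(y_i\mapsto\vec t_i*\phi_i)\curlywedge\xi_i$ ($i=1,2$) with the same head, renamed apart, $\vec x_1\approx\vec x_2\wedge\vec t_1\approx\vec t_2\wedge\xi_1\wedge\xi_2$ is unsatisfiable (tuple equations being false for tuples of different lengths or componentwise sorts), and (ii) every disequation in its rules is $x\not\approx y$ with $x,y\in\mathcal V_{\mathtt{loc}}$. -}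

module Defs where

open import Data.Nat using (ℕ; zero; suc; _≤_)
open import Data.Product using (Σ; ∃; ∃-syntax; _×_; _,_)
open import Data.Sum using (_⊎_)
open import Data.Maybe using (Maybe; just; nothing)
open import Data.List using (List; []; _∷_; _++_; map)
open import Data.List.Relation.Unary.All using (All; []; _∷_)
open import Data.List.Membership.Propositional using (_∈_; _∉_)
open import Data.List.Relation.Unary.Unique.Propositional using (Unique)
open import Data.List.Relation.Binary.Permutation.Propositional using (_↭_)
open import Relation.Binary.PropositionalEquality using (_≡_; _≢_)
open import Relation.Nullary using (¬_)
open import Data.Empty using (⊥)

data At {A : Set} : List A → ℕ → A → Set where
  here  : ∀ {a as} → At (a ∷ as) zero a
  there : ∀ {a b as i} → At as i a → At (b ∷ as) (suc i) a

-- {x,y} ⊆_m M : x and y occur in M as two distinct occurrences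
TwoOcc : {A : Set} → List A → A → A → Set
TwoOcc M x y = ∃[ i ] ∃[ j ] (i ≢ j × At M i x × At M j y)

-- Variables of sort s are V_s = ℕ (one countably infinite copy per sort,
-- disjoint since a variable is a pair (sort , index)).
-- The universe U_s is a tagged copy {s} × ℕ of ℕ (pairwise disjoint,
-- countably infinite); constants are interpreted by an injective dot.
-- A predicate p has profile (loc , arity p), i.e. s_1 = loc, n ≥ 1.

record Signature : Set₁ where
  field
    Sort       : Set
    loc        : Sort
    Const      : Sort → Set
    noLocConst : ¬ Const loc
    dot        : ∀ {s} → Const s → ℕ
    dot-inj    : ∀ {s} {c d : Const s} → dot c ≡ dot d → c ≡ d
    Pred       : Set
    arity      : Pred → List Sort

module Logic (Sig : Signature) where
  open Signature Sig

  data Term (s : Sort) : Set where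
    var : ℕ → Term s
    con : Const s → Term s

  STerm : Set
  STerm = Σ Sort Term

  data PAtom : Set where
    _≈_ : ∀ {s} → Term s → Term s → PAtom
    _≉_ : ∀ {s} → Term s → Term s → PAtom

  PureF : Set
  PureF = List PAtom

  record Call : Set where
    constructor call
    field
      pred : Pred
      root : ℕ
      args : All Term (arity pred)

  data SAtom : Set where
    _↦_ : ℕ → List STerm → SAtom
    ⟨_⟩ : Call → SAtom

  -- spatial formula: separating conjunction (list, [] = emp)
  record SH : Set where
    constructor _⋏_
    field
      spatial : List SAtom
      pure    : PureF
  open SH public

  allList : ∀ {P : Sort → Set} {ss : List Sort} → All P ss → List (Σ Sort P)
  allList {ss = []} [] = []
  allList {ss = s ∷ ss} (p ∷ ps) = (s , p) ∷ allList ps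

  callArgs : Call → List STerm
  callArgs (call p x ts) = (loc , var x) ∷ allList ts

  root : SAtom → ℕ
  root (x ↦ _) = x
  root ⟨ c ⟩ = Call.root c

  alloc : SH → List ℕ
  alloc φ = map root (spatial φ)

  callsOf : List SAtom → List Call
  callsOf [] = []
  callsOf ((_ ↦ _) ∷ as) = callsOf as
  callsOf (⟨ c ⟩ ∷ as) = c ∷ callsOf as

  record Rule : Set where
    field
      head   : Pred
      x₁     : ℕ
      params : All (λ _ → ℕ) (arity head)
      body   : SH

  paramVars : Rule → List (Σ Sort (λ _ → ℕ))
  paramVars r = (loc , Rule.x₁ r) ∷ allList (Rule.params r)

  paramTerms : Rule → List STerm
  paramTerms r = map (λ { (s , x) → (s , var x) }) (paramVars r)

  Val : Set
  Val = Σ Sort (λ _ → ℕ)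

  Store : Set
  Store = Sort → ℕ → ℕ            -- sort-preserving by construction

  ⟦_⟧_ : ∀ {s} → Term s → Store → ℕ
  ⟦_⟧_ {s} (var x) st = st s x
  ⟦ con c ⟧ st = dot c

  evalS : Store → STerm → Val
  evalS st (s , t) = s , ⟦ t ⟧ st

  evalL : Store → List STerm → List Val
  evalL st = map (evalS st)

  Heap : Set
  Heap = ℕ → Maybe (List Val)

  FiniteHeap : Heap → Set
  FiniteHeap h = ∃[ dom ] (∀ l → h l ≢ nothing → l ∈ dom)

  dom : Heap → ℕ → Set
  dom h l = h l ≢ nothing

  Emp : Heap → Set
  Emp h = ∀ l → h l ≡ nothing

  Cell : Heap → ℕ → List Val → Set
  Cell h l v = h l ≡ just v × (∀ l' → l' ≢ l → h l' ≡ nothing)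

  Split : Heap → Heap → Heap → Set
  Split h h₁ h₂ = ∀ l → (h₁ l ≡ nothing × h l ≡ h₂ l) ⊎ (h₂ l ≡ nothing × h l ≡ h₁ l)

  AtomSat : Store → PAtom → Set
  AtomSat st (t ≈ u) = ⟦ t ⟧ st ≡ ⟦ u ⟧ st
  AtomSat st (t ≉ u) = ⟦ t ⟧ st ≢ ⟦ u ⟧ st

  _⊨ₚ_ : Store → PureF → Set
  st ⊨ₚ ξ = All (AtomSat st) ξ

  module _ (R : List Rule) where
    mutual
      data SatSp (st : Store) : Heap → List SAtom → Set where
        emp : ∀ {h} → Emp h → SatSp st h []
        sep : ∀ {h h₁ h₂ a φ} → Split h h₁ h₂ →
              SatAt st h₁ a → SatSp st h₂ φ → SatSp st h (a ∷ φ)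

      data SatAt (st : Store) : Heap → SAtom → Set where
        pto  : ∀ {h x ts} → Cell h (st loc x) (evalL st ts) → SatAt st h (x ↦ ts)
        unfold : ∀ {h c} (r : Rule) → r ∈ R → Rule.head r ≡ Call.pred c →
                 (st' : Store) →
                 map (λ { (s , x) → (s , st' s x) }) (paramVars r) ≡ evalL st (callArgs c) →
                 SatSp st' h (spatial (Rule.body r)) → st' ⊨ₚ pure (Rule.body r) →
                 SatAt st h ⟨ c ⟩

    Models : Store → Heap → SH → Set
    Models st h φ = SatSp st h (spatial φ) × st ⊨ₚ pure φ

  data IsConst {s : Sort} : Term s → Set where
    isCon : ∀ {c} → IsConst (con c)

  module _ (xs ys : List STerm) where
    data PDiseq : PAtom → Set where
      diseq : ∀ {s} {u v : Term s} → (s , u) ∈ xs ++ ys → (s , v) ∈ ys →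
              (s , v) ∉ xs → PDiseq (u ≉ v)

    ArgOK : STerm → Set
    ArgOK (s , t) = IsConst t ⊎ (s , t) ∈ xs ++ ys

  record IsPRule (r : Rule) : Set where
    field
      distinct   : Unique (paramVars r)
      ys         : List STerm
      calls      : List Call
      shape      : spatial (Rule.body r) ↭ ((Rule.x₁ r ↦ ys) ∷ map ⟨_⟩ calls)
      pureCond   : All (PDiseq (paramTerms r) ys) (pure (Rule.body r))
      rootsCond  : ∀ z → (z ∈ map Call.root calls →
                            (loc , var z) ∈ ys × (loc , var z) ∉ paramTerms r)
                       × ((loc , var z) ∈ ys × (loc , var z) ∉ paramTerms r →
                            z ∈ map Call.root calls)
      rootsDist  : Unique (map Call.root calls)
      argsCond   : All (λ c → All (ArgOK (paramTerms r) ys) (allList (Call.args c))) calls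

  data Productive (R : List Rule) : Pred → Set where
    prod : ∀ {r} → r ∈ R →
           All (λ c → Productive R (Call.pred c)) (callsOf (spatial (Rule.body r))) →
           Productive R (Rule.head r)

  A1 : List Rule → Set
  A1 R = ∀ p → Productive R p

  -- out(p), with 0-based positions (position 0 is the root x_1)
  data Out (R : List Rule) : Pred → ℕ → Set where
    outPto  : ∀ {r i x ts} → r ∈ R → At (paramVars r) i (loc , x) →
              (Rule.x₁ r ↦ ts) ∈ spatial (Rule.body r) → (loc , var x) ∈ ts →
              Out R (Rule.head r) i
    outCall : ∀ {r i x c j} → r ∈ R → At (paramVars r) i (loc , x) →
              ⟨ c ⟩ ∈ spatial (Rule.body r) → At (callArgs c) j (loc , var x) →
              Out R (Call.pred c) j → Out R (Rule.head r) i

  A2 : List Rule → Set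
  A2 R = ∀ p i → 1 ≤ i → At (loc ∷ arity p) i loc → Out R p i

  data LocDiseq : PAtom → Set where
    eqAtom  : ∀ {s} {t u : Term s} → LocDiseq (t ≈ u)
    locNeq  : ∀ {x y} → LocDiseq (_≉_ {loc} (var x) (var y))

  -- loc-determinism; "renamed apart" is rendered by using two
  -- independent stores for the two rules
  LocDeterministic : List Rule → Set
  LocDeterministic R =
    (∀ {r₁ r₂} → r₁ ∈ R → r₂ ∈ R → r₁ ≢ r₂ → Rule.head r₁ ≡ Rule.head r₂ →
       ∀ {y₁ ts₁ y₂ ts₂} →
       (y₁ ↦ ts₁) ∈ spatial (Rule.body r₁) → (y₂ ↦ ts₂) ∈ spatial (Rule.body r₂) →
       ∀ (st₁ st₂ : Store) →
       evalL st₁ (paramTerms r₁) ≡ evalL st₂ (paramTerms r₂) →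
       evalL st₁ ts₁ ≡ evalL st₂ ts₂ →
       st₁ ⊨ₚ pure (Rule.body r₁) → st₂ ⊨ₚ pure (Rule.body r₂) → ⊥)
    × (∀ {r} → r ∈ R → All LocDiseq (pure (Rule.body r)))

  data Entailed (φ : SH) (V : List ℕ) : PAtom → Set where
    occurs   : ∀ {ζ} → ζ ∈ pure φ → Entailed φ V ζ
    reflVar  : ∀ {s x} → Entailed φ V (_≈_ {s} (var x) (var x))
    constNeq : ∀ {s} {c d : Const s} → c ≢ d → Entailed φ V (con c ≉ con d)
    allocNeq : ∀ {x₁ x₂} → TwoOcc (alloc φ ++ V) x₁ x₂ →
               Entailed φ V (_≉_ {loc} (var x₁) (var x₂))

  _▷[_]_ : SH → List ℕ → PureF → Set
  φ ▷[ V ] ξ = All (Entailed φ V) ξ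

  InjectiveOn : Store → List ℕ → Set
  InjectiveOn st V = ∀ x y → TwoOcc V x y → st loc x ≢ st loc y

{-# OPTIONS --safe #-}
-- Every root of a satisfied spatial formula is allocated: a points-to atom
-- allocates its cell, and a predicate atom is unfolded by a P-rule whose body
-- begins with a points-to atom on the root.  Separation therefore makes the
-- roots of distinct atom occurrences distinct, while the variables of V are
-- mapped outside the heap and injectively.  So every disequation justified by
-- alloc(λ) + V holds; the other entailed atoms hold trivially or by hypothesis.
module Submission where

open import Defs
open import Data.Nat using (ℕ; suc; _+_)
open import Data.Product using (_×_; _,_; proj₂; ∃-syntax)
open import Data.Sum using (_⊎_; inj₁; inj₂)
open import Data.List using (List; []; _∷_; _++_; map; length)
open import Data.List.Properties using (∷-injectiveˡ)
open import Data.List.Membership.Propositional using (_∈_)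
open import Data.List.Membership.Propositional.Properties using (∈-map⁺)
open import Data.List.Relation.Unary.Any using (here; there)
open import Data.List.Relation.Unary.All as All using (All; lookup)
open import Data.List.Relation.Binary.Permutation.Propositional using (↭-sym)
open import Data.List.Relation.Binary.Permutation.Propositional.Properties using (∈-resp-↭)
open import Data.Empty using (⊥)
open import Data.Maybe using (nothing)
open import Function using (_∘_)
open import Relation.Binary.PropositionalEquality using (_≡_; _≢_; refl; sym; trans; cong; subst)

At⇒∈ : ∀ {A : Set} {xs : List A} {i a} → At xs i a → a ∈ xs
At⇒∈ here      = here refl
At⇒∈ (there p) = there (At⇒∈ p)

At-++⁻ : ∀ {A : Set} (xs : List A) {ys i a} → At (xs ++ ys) i a →
         At xs i a ⊎ ∃[ k ] (At ys k a × i ≡ length xs + k)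
At-++⁻ []       p         = inj₂ (_ , p , refl)
At-++⁻ (x ∷ xs) here      = inj₁ here
At-++⁻ (x ∷ xs) (there p) with At-++⁻ xs p
... | inj₁ q           = inj₁ (there q)
... | inj₂ (k , q , e) = inj₂ (k , q , cong suc e)

TwoOcc-++⁻ : ∀ {A : Set} (xs : List A) {ys x y} → TwoOcc (xs ++ ys) x y →
             TwoOcc xs x y ⊎ (x ∈ xs × y ∈ ys) ⊎ (x ∈ ys × y ∈ xs) ⊎ TwoOcc ys x y
TwoOcc-++⁻ xs (i , j , i≢j , p , q) with At-++⁻ xs p | At-++⁻ xs q
... | inj₁ p′            | inj₁ q′            = inj₁ (i , j , i≢j , p′ , q′)
... | inj₁ p′            | inj₂ (_ , q′ , _)  = inj₂ (inj₁ (At⇒∈ p′ , At⇒∈ q′))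
... | inj₂ (_ , p′ , _)  | inj₁ q′            = inj₂ (inj₂ (inj₁ (At⇒∈ p′ , At⇒∈ q′)))
... | inj₂ (k , p′ , i≡) | inj₂ (l , q′ , j≡) =
  inj₂ (inj₂ (inj₂ (k , l , k≢l , p′ , q′)))
  where
    k≢l : k ≢ l
    k≢l k≡l = i≢j (trans i≡ (trans (cong (length xs +_) k≡l) (sym j≡)))

module _ (Sig : Signature) where
  open Signature Sig
  open Logic Sig

  module _ {h h₁ h₂ : Heap} (split : Split h h₁ h₂) {l : ℕ} where

    dom-splitˡ : dom h₁ l → dom h l
    dom-splitˡ d with split l
    ... | inj₁ (h₁l≡nothing , _) = λ _ → d h₁l≡nothing
    ... | inj₂ (_ , hl≡h₁l)      = d ∘ trans (sym hl≡h₁l)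

    dom-splitʳ : dom h₂ l → dom h l
    dom-splitʳ d with split l
    ... | inj₁ (_ , hl≡h₂l)      = d ∘ trans (sym hl≡h₂l)
    ... | inj₂ (h₂l≡nothing , _) = λ _ → d h₂l≡nothing

    split-disjoint : dom h₁ l → dom h₂ l → ⊥
    split-disjoint d₁ d₂ with split l
    ... | inj₁ (h₁l≡nothing , _) = d₁ h₁l≡nothing
    ... | inj₂ (h₂l≡nothing , _) = d₂ h₂l≡nothing

  RootAllocating : Rule → Set
  RootAllocating r = Rule.x₁ r ∈ alloc (Rule.body r)

  pRule⇒rootAllocating : ∀ {r} → IsPRule r → RootAllocating r
  pRule⇒rootAllocating P =
    ∈-map⁺ root (∈-resp-↭ (↭-sym (IsPRule.shape P)) (here refl))

  module _ (R : List Rule) (rootAlloc : All RootAllocating R) where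

    mutual
      root-allocated : ∀ {st h a} → SatAt R st h a → dom h (st loc (root a))
      root-allocated (pto (hx≡just , _)) hx≡nothing with trans (sym hx≡just) hx≡nothing
      ... | ()
      root-allocated {h = h} (unfold r r∈R _ st′ params≡args body _) =
        subst (dom h) (cong proj₂ (∷-injectiveˡ params≡args))
              (roots-allocated body (lookup rootAlloc r∈R))

      roots-allocated : ∀ {st h φ x} → SatSp R st h φ → x ∈ map root φ → dom h (st loc x)
      roots-allocated (sep split a _) (here refl) = dom-splitˡ split (root-allocated a)
      roots-allocated (sep split _ φ) (there x∈) = dom-splitʳ split (roots-allocated φ x∈)

    roots-injective : ∀ {st h φ x y} → SatSp R st h φ → TwoOcc (map root φ) x y →
                      st loc x ≢ st loc y
    roots-injective (sep _ _ _) (_ , _ , i≢j , here , here) _ = i≢j refl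
    roots-injective (sep {h₂ = h₂} split a φ) (_ , _ , _ , here , there q) x≡y =
      split-disjoint split (root-allocated a)
        (subst (dom h₂) (sym x≡y) (roots-allocated φ (At⇒∈ q)))
    roots-injective (sep {h₂ = h₂} split a φ) (_ , _ , _ , there p , here) x≡y =
      split-disjoint split (root-allocated a)
        (subst (dom h₂) x≡y (roots-allocated φ (At⇒∈ p)))
    roots-injective (sep _ _ φ) (_ , _ , i≢j , there p , there q) =
      roots-injective φ (_ , _ , i≢j ∘ cong suc , p , q)

    injectiveOn-alloc++ : ∀ {st h φ V} → SatSp R st h (spatial φ) →
                          (∀ x → x ∈ V → h (st loc x) ≡ nothing) → InjectiveOn st V →
                          InjectiveOn st (alloc φ ++ V)
    injectiveOn-alloc++ {h = h} {φ = φ} sat V∉dom injV x y occ with TwoOcc-++⁻ (alloc φ) occ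
    ... | inj₁ occ′                       = roots-injective sat occ′
    ... | inj₂ (inj₁ (x∈ , y∈))           = λ x≡y →
      roots-allocated sat x∈ (trans (cong h x≡y) (V∉dom y y∈))
    ... | inj₂ (inj₂ (inj₁ (x∈ , y∈)))    = λ x≡y →
      roots-allocated sat y∈ (trans (cong h (sym x≡y)) (V∉dom x x∈))
    ... | inj₂ (inj₂ (inj₂ occ′))         = injV x y occ′

    entailed-sound : ∀ {st h φ V ζ} → Models R st h φ →
                     (∀ x → x ∈ V → h (st loc x) ≡ nothing) → InjectiveOn st V →
                     Entailed φ V ζ → AtomSat st ζ
    entailed-sound (_ , pureSat) _ _ (occurs ζ∈)  = lookup pureSat ζ∈
    entailed-sound _ _ _ reflVar                   = refl
    entailed-sound _ _ _ (constNeq c≢d)            = c≢d ∘ dot-inj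
    entailed-sound {φ = φ} (sat , _) V∉dom injV (allocNeq occ) =
      injectiveOn-alloc++ {φ = φ} sat V∉dom injV _ _ occ

lemma5 : (Sig : Signature) → let open Logic Sig in
    (R : List Rule) → R ≢ [] → All IsPRule R → LocDeterministic R → A1 R → A2 R →
    (φ : SH) (ξ : PureF) (V : List ℕ) → φ ▷[ V ] ξ →
    (st : Store) (h : Heap) → FiniteHeap h →
    Models R st h φ →
    (∀ x → x ∈ V → h (st (Signature.loc Sig) x) ≡ nothing) →
    InjectiveOn st V →
    st ⊨ₚ ξ
lemma5 Sig R _ pRules _ _ _ φ ξ V φ▷ξ st h _ sat V∉dom injV =
  All.map (entailed-sound Sig R (All.map (pRule⇒rootAllocating Sig) pRules) sat V∉dom injV) φ▷ξ
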